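{- If $G$ is a graph that has a min-max clique covering with simple intersection, then both $G$ and its compressed cliques graph $\mathcal{C}(G)$ are claw-free (contain no induced subgraph isomorphic to $K_{1,3}$).
   Context: A clique is a set of vertices inducing a complete subgraph; maximal if no vertex can be added. A clique covering is a set of cliques such that every edge lies inside one of them; $\mathrm{cc}(G)$ is the minimum size of a clique covering; a min-max clique covering is one of size $\mathrm{cc}(G)$ all of whose cliques are maximal. A covering $\{C_1,\dots,C_\ell\}$ has simple intersection if no vertex lies in three distinct $C_i$. For such a covering define, for $i\neq j$, $C_{i,j}=C_i\cap C_j$, and $C_{i,i}=C_i\setminus\bigcup_{j\neq i}C_j$. The compressed cliques graph $\mathcal{C}(G)$ has one vertex $v_{i,j}$ for each nonempty $C_{i,j}$ (unordered pairs, $i=j$ allowed), distinct $v_{i,j},v_{i',j'}$ adjacent iff $\{i,j\}\cap\{i',j'\}\neq\emptyset$. -}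

module Defs where

open import Level using (0ℓ)
open import Data.Nat using (ℕ; _≤_)
open import Data.Fin using (Fin; toℕ)
open import Data.Fin.Subset using (Subset; _∈_; _∉_; _∪_; ⁅_⁆)
open import Data.Product using (Σ; ∃; ∃-syntax; _×_; _,_)
open import Data.Sum using (_⊎_)
open import Data.Empty using (⊥)
open import Data.Unit using (⊤)
open import Relation.Nullary using (¬_)
open import Relation.Binary.PropositionalEquality using (_≡_; _≢_)

record Graph (n : ℕ) : Set₁ where
  field
    Adj    : Fin n → Fin n → Set
    sym    : ∀ {x y} → Adj x y → Adj y x
    irrefl : ∀ {x} → ¬ Adj x x
open Graph public

module _ {n : ℕ} (G : Graph n) where

  IsClique : Subset n → Set
  IsClique C = ∀ x y → x ∈ C → y ∈ C → x ≢ y → Adj G x y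

  IsMaximalClique : Subset n → Set
  IsMaximalClique C = IsClique C × (∀ v → v ∉ C → ¬ IsClique (⁅ v ⁆ ∪ C))

  IsCliqueCovering : (ℓ : ℕ) → (Fin ℓ → Subset n) → Set
  IsCliqueCovering ℓ Cs =
    (∀ i → IsClique (Cs i)) ×
    (∀ x y → Adj G x y → ∃[ i ] (x ∈ Cs i × y ∈ Cs i))

  IsMinCliqueCovering : (ℓ : ℕ) → (Fin ℓ → Subset n) → Set
  IsMinCliqueCovering ℓ Cs =
    IsCliqueCovering ℓ Cs ×
    (∀ m (Ds : Fin m → Subset n) → IsCliqueCovering m Ds → ℓ ≤ m)

  IsMinMaxCliqueCovering : (ℓ : ℕ) → (Fin ℓ → Subset n) → Set
  IsMinMaxCliqueCovering ℓ Cs =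
    IsMinCliqueCovering ℓ Cs × (∀ i → IsMaximalClique (Cs i))

SimpleIntersection : ∀ {n ℓ} → (Fin ℓ → Subset n) → Set
SimpleIntersection {n} {ℓ} Cs =
  ∀ (v : Fin n) (i j k : Fin ℓ) → i ≢ j → j ≢ k → i ≢ k →
  v ∈ Cs i → v ∈ Cs j → v ∈ Cs k → ⊥

InC : ∀ {n ℓ} → (Fin ℓ → Subset n) → Fin ℓ → Fin ℓ → Fin n → Set
InC Cs i j v =
  (i ≡ j × v ∈ Cs i × (∀ k → k ≢ i → v ∉ Cs k)) ⊎
  (i ≢ j × v ∈ Cs i × v ∈ Cs j)

-- Vertices of the compressed cliques graph: unordered pairs {i,j}, represented
-- by ordered pairs (i , j) with i ≤ j, such that C_{i,j} is nonempty.
CVertex : ∀ {n ℓ} → (Fin ℓ → Subset n) → Fin ℓ × Fin ℓ → Set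
CVertex Cs (i , j) = toℕ i ≤ toℕ j × ∃[ v ] InC Cs i j v

CAdj : ∀ {ℓ} → Fin ℓ × Fin ℓ → Fin ℓ × Fin ℓ → Set
CAdj (i , j) (i' , j') =
  (i , j) ≢ (i' , j') × (i ≡ i' ⊎ i ≡ j' ⊎ j ≡ i' ⊎ j ≡ j')

ClawFree : {V : Set} → (V → Set) → (V → V → Set) → Set
ClawFree {V} P E =
  ∀ (c a b d : V) → P c → P a → P b → P d →
  c ≢ a → c ≢ b → c ≢ d → a ≢ b → a ≢ d → b ≢ d →
  ¬ (E c a × E c b × E c d × ¬ E a b × ¬ E a d × ¬ E b d)

AllV : ∀ {n} → Fin n → Set
AllV _ = ⊤

module Submission where

-- A claw centred at c with leaves a, b, d: the edges ca, cb, cd lie in cliques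
-- C_i, C_j, C_k of the covering, pairwise distinct because the leaves are pairwise
-- non-adjacent, so c lies in three cliques, against simple intersection.
-- In 𝒞(G) every neighbour of v_{i,j} contains i or j, so two of the three leaves
-- share an index and are adjacent.

open import Defs
open import Data.Nat using (ℕ)
open import Data.Fin using (Fin)
open import Data.Fin.Subset using (Subset)
open import Data.Product using (_×_; _,_)
open import Data.Sum using (_⊎_; inj₁; inj₂)
open import Relation.Binary.PropositionalEquality as ≡ using (_≡_; _≢_; refl)

_∈ₚ_ : ∀ {ℓ} → Fin ℓ → Fin ℓ × Fin ℓ → Set
x ∈ₚ (p , q) = x ≡ p ⊎ x ≡ q

CAdj⇒∈ₚ : ∀ {ℓ} (i j : Fin ℓ) (a : Fin ℓ × Fin ℓ) →
  CAdj (i , j) a → i ∈ₚ a ⊎ j ∈ₚ a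
CAdj⇒∈ₚ i j (p , q) (_ , inj₁ i≡p)                 = inj₁ (inj₁ i≡p)
CAdj⇒∈ₚ i j (p , q) (_ , inj₂ (inj₁ i≡q))          = inj₁ (inj₂ i≡q)
CAdj⇒∈ₚ i j (p , q) (_ , inj₂ (inj₂ (inj₁ j≡p)))   = inj₂ (inj₁ j≡p)
CAdj⇒∈ₚ i j (p , q) (_ , inj₂ (inj₂ (inj₂ j≡q)))   = inj₂ (inj₂ j≡q)

∈ₚ⇒CAdj : ∀ {ℓ} (x : Fin ℓ) (a b : Fin ℓ × Fin ℓ) →
  x ∈ₚ a → x ∈ₚ b → a ≢ b → CAdj a b
∈ₚ⇒CAdj x (p , q) (p' , q') (inj₁ x≡p) (inj₁ x≡p') a≢b =
  a≢b , inj₁ (≡.trans (≡.sym x≡p) x≡p')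
∈ₚ⇒CAdj x (p , q) (p' , q') (inj₁ x≡p) (inj₂ x≡q') a≢b =
  a≢b , inj₂ (inj₁ (≡.trans (≡.sym x≡p) x≡q'))
∈ₚ⇒CAdj x (p , q) (p' , q') (inj₂ x≡q) (inj₁ x≡p') a≢b =
  a≢b , inj₂ (inj₂ (inj₁ (≡.trans (≡.sym x≡q) x≡p')))
∈ₚ⇒CAdj x (p , q) (p' , q') (inj₂ x≡q) (inj₂ x≡q') a≢b =
  a≢b , inj₂ (inj₂ (inj₂ (≡.trans (≡.sym x≡q) x≡q')))

CAdj-clawFree : ∀ {ℓ} (P : Fin ℓ × Fin ℓ → Set) → ClawFree P CAdj
CAdj-clawFree P (i , j) a b d _ _ _ _ _ _ _ a≢b a≢d b≢d
  (ca , cb , cd , ¬ab , ¬ad , ¬bd)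
  with CAdj⇒∈ₚ i j a ca | CAdj⇒∈ₚ i j b cb | CAdj⇒∈ₚ i j d cd
... | inj₁ i∈a | inj₁ i∈b | _        = ¬ab (∈ₚ⇒CAdj i a b i∈a i∈b a≢b)
... | inj₂ j∈a | inj₂ j∈b | _        = ¬ab (∈ₚ⇒CAdj j a b j∈a j∈b a≢b)
... | inj₁ i∈a | _        | inj₁ i∈d = ¬ad (∈ₚ⇒CAdj i a d i∈a i∈d a≢d)
... | inj₂ j∈a | _        | inj₂ j∈d = ¬ad (∈ₚ⇒CAdj j a d j∈a j∈d a≢d)
... | _        | inj₁ i∈b | inj₁ i∈d = ¬bd (∈ₚ⇒CAdj i b d i∈b i∈d b≢d)
... | _        | inj₂ j∈b | inj₂ j∈d = ¬bd (∈ₚ⇒CAdj j b d j∈b j∈d b≢d)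

simpleIntersectionCovering⇒clawFree :
  ∀ {n ℓ} (G : Graph n) (Cs : Fin ℓ → Subset n) →
  IsCliqueCovering G ℓ Cs → SimpleIntersection Cs →
  ClawFree (AllV {n}) (Adj G)
simpleIntersectionCovering⇒clawFree G Cs (cliques , covers) simple
  c a b d _ _ _ _ _ _ _ a≢b a≢d b≢d (ca , cb , cd , ¬ab , ¬ad , ¬bd)
  with covers c a ca | covers c b cb | covers c d cd
... | i , c∈Cᵢ , a∈Cᵢ | j , c∈Cⱼ , b∈Cⱼ | k , c∈Cₖ , d∈Cₖ =
  simple c i j k i≢j j≢k i≢k c∈Cᵢ c∈Cⱼ c∈Cₖ
  where
  i≢j : i ≢ j
  i≢j refl = ¬ab (cliques i a b a∈Cᵢ b∈Cⱼ a≢b)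
  j≢k : j ≢ k
  j≢k refl = ¬bd (cliques j b d b∈Cⱼ d∈Cₖ b≢d)
  i≢k : i ≢ k
  i≢k refl = ¬ad (cliques i a d a∈Cᵢ d∈Cₖ a≢d)

proposition9p1 : ∀ {n : ℕ} (G : Graph n) (ℓ : ℕ) (Cs : Fin ℓ → Subset n) →
    IsMinMaxCliqueCovering G ℓ Cs → SimpleIntersection Cs →
    ClawFree (AllV {n}) (Adj G) × ClawFree (CVertex Cs) CAdj
proposition9p1 G ℓ Cs ((covering , _) , _) simple =
  simpleIntersectionCovering⇒clawFree G Cs covering simple ,
  CAdj-clawFree (CVertex Cs)
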